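{- If $n\in L_\infty$, then $n$ is a cyclic number, i.e., $\gcd(n,\varphi(n))=1$, and consequently $n$ is square-free.
   Context: $\varphi$ is Euler's totient function. For $k\in\mathbb{N}$, $L_k=\{n\in\mathbb{N} : \varphi(n)\mid (n-1)^k\}$, and $L_\infty=\bigcup_{k\ge1}L_k$; equivalently $L_\infty=\{n\in\mathbb{N}:\operatorname{rad}(\varphi(n))\mid n-1\}$, where $\operatorname{rad}(m)$ is the product of the distinct primes dividing $m$. -}

module Defs where

open import Data.Nat using (ℕ; suc; _+_; _*_; _∸_; _^_)
open import Data.Nat.GCD using (gcd)
open import Data.Nat.Divisibility using (_∣_)
open import Data.List using (List; filter; length; upTo; map)
open import Data.Nat.Properties using (_≟_)
open import Relation.Binary.PropositionalEquality using (_≡_)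

φ : ℕ → ℕ
φ n = length (filter (λ k → gcd k n ≟ 1) (map suc (upTo n)))

-- L_k = { n : φ(n) ∣ (n-1)^k }   (n ≥ 1 is imposed where used)
InL : ℕ → ℕ → Set
InL k n = φ n ∣ (n ∸ 1) ^ k

SquareFree : ℕ → Set
SquareFree n = ∀ d → d * d ∣ n → d ≡ 1

module Submission where

-- Cyclicity.  If φ(n) ∣ (n-1)^k, a common divisor of n and φ(n) divides
-- (n-1)^k, which is coprime to n because n-1 is.
--
-- If d² ∣ n, write n = d·m with
-- d ∣ m.  Then n and m have the same coprime residues, and coprimality to m
-- is m-periodic, so counting coprime residues in {1,…,dm} block by block
-- gives φ(d·m) = d·φ(m).  Thus d divides both n and φ(n), so d = 1.

open import Defs
open import Data.Nat using (ℕ; suc; zero; _≥_; _+_; _*_; _^_; s≤s)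
open import Data.Nat.Properties using (_≟_; +-assoc; +-suc; +-comm; +-identityʳ; *-assoc; *-comm)
open import Data.Nat.GCD using (gcd)
open import Data.Nat.Divisibility using (_∣_; divides; ∣-trans; ∣m∣n⇒∣m+n; m∣m*n; ∣1⇒≡1)
open import Data.Nat.Coprimality
  using (Coprime; coprime⇒gcd≡1; gcd≡1⇒coprime; coprime-divisor; coprime-+; 1-coprimeTo)
open import Data.Bool using (Bool; if_then_else_)
open import Data.List using ([_]; _++_; filter; length; upTo; map)
open import Data.List.Properties using (filter-++; length-++; upTo-∷ʳ; map-++)
open import Data.Product using (∃-syntax; _×_; _,_)
open import Function using (_∘_)
open import Function.Bundles using (mk⇔)
open import Relation.Nullary using (yes; no; does)
open import Relation.Nullary.Decidable using (does-⇔)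
open import Level using (0ℓ)
open import Relation.Unary using (Pred; Decidable)
open import Relation.Binary.PropositionalEquality using (_≡_; refl; sym; trans; cong; cong₂; subst; module ≡-Reasoning)
open ≡-Reasoning

count : (ℕ → Bool) → ℕ → ℕ
count p zero    = 0
count p (suc x) = count p x + (if p (suc x) then 1 else 0)

length-filter-upTo : ∀ {P : Pred ℕ 0ℓ} (P? : Decidable P) x →
                     length (filter P? (map suc (upTo x))) ≡ count (does ∘ P?) x
length-filter-upTo P? zero    = refl
length-filter-upTo P? (suc x) = begin
  length (filter P? (map suc (upTo (suc x))))
    ≡⟨ cong (length ∘ filter P? ∘ map suc) (sym (upTo-∷ʳ x)) ⟩
  length (filter P? (map suc (upTo x ++ [ x ])))
    ≡⟨ cong (length ∘ filter P?) (map-++ suc (upTo x) [ x ]) ⟩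
  length (filter P? (map suc (upTo x) ++ [ suc x ]))
    ≡⟨ cong length (filter-++ P? (map suc (upTo x)) [ suc x ]) ⟩
  length (filter P? (map suc (upTo x)) ++ filter P? [ suc x ])
    ≡⟨ length-++ (filter P? (map suc (upTo x))) ⟩
  length (filter P? (map suc (upTo x))) + length (filter P? [ suc x ])
    ≡⟨ cong₂ _+_ (length-filter-upTo P? x) (length-filter-singleton (suc x)) ⟩
  count (does ∘ P?) (suc x) ∎
  where
  length-filter-singleton : ∀ y → length (filter P? [ y ]) ≡ (if does (P? y) then 1 else 0)
  length-filter-singleton y with P? y
  ... | yes _ = refl
  ... | no  _ = refl

count-cong : ∀ {p q} → (∀ k → p k ≡ q k) → ∀ x → count p x ≡ count q x
count-cong p≗q zero    = refl
count-cong p≗q (suc x) = cong₂ _+_ (count-cong p≗q x) (cong (λ b → if b then 1 else 0) (p≗q (suc x)))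

count-+ : ∀ p a b → count p (a + b) ≡ count p a + count (p ∘ (a +_)) b
count-+ p a zero    rewrite +-identityʳ a = sym (+-identityʳ (count p a))
count-+ p a (suc b) rewrite +-suc a b =
  trans (cong (_+ (if p (suc (a + b)) then 1 else 0)) (count-+ p a b))
        (+-assoc (count p a) (count (p ∘ (a +_)) b) _)

count-periodic : ∀ p m → (∀ k → p (m + k) ≡ p k) → ∀ j → count p (j * m) ≡ j * count p m
count-periodic p m periodic zero    = refl
count-periodic p m periodic (suc j) = begin
  count p (m + j * m)                    ≡⟨ count-+ p m (j * m) ⟩
  count p m + count (p ∘ (m +_)) (j * m) ≡⟨ cong (count p m +_) (count-cong periodic (j * m)) ⟩
  count p m + count p (j * m)            ≡⟨ cong (count p m +_) (count-periodic p m periodic j) ⟩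
  count p m + j * count p m              ∎

coprimeTo : ℕ → ℕ → Bool
coprimeTo n k = does (gcd k n ≟ 1)

φ≡count : ∀ n → φ n ≡ count (coprimeTo n) n
φ≡count n = length-filter-upTo (λ k → gcd k n ≟ 1) n

coprimeTo-⇔ : ∀ {n m k l} → (Coprime k n → Coprime l m) → (Coprime l m → Coprime k n) →
              coprimeTo n k ≡ coprimeTo m l
coprimeTo-⇔ {n} {m} {k} {l} to from = does-⇔
  (mk⇔ (coprime⇒gcd≡1 ∘ to ∘ gcd≡1⇒coprime) (coprime⇒gcd≡1 ∘ from ∘ gcd≡1⇒coprime))
  (gcd k n ≟ 1) (gcd l m ≟ 1)

coprime-* : ∀ {k a b} → Coprime k a → Coprime k b → Coprime k (a * b)
coprime-* k⊥a k⊥b (i∣k , i∣ab) =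
  k⊥b (i∣k , coprime-divisor (λ (j∣i , j∣a) → k⊥a (∣-trans j∣i i∣k , j∣a)) i∣ab)

coprime-^ : ∀ {k a} → Coprime k a → ∀ e → Coprime k (a ^ e)
coprime-^ k⊥a zero    = λ (_ , i∣1) → ∣1⇒≡1 i∣1
coprime-^ k⊥a (suc e) = coprime-* k⊥a (coprime-^ k⊥a e)

coprime-suc : ∀ n → Coprime (suc n) n
coprime-suc n = subst (λ s → Coprime s n) (+-comm n 1) (coprime-+ (1-coprimeTo n))

coprimeTo-periodic : ∀ m k → coprimeTo m (m + k) ≡ coprimeTo m k
coprimeTo-periodic m k = coprimeTo-⇔ {k = m + k} {l = k}
  (λ mk⊥m (i∣k , i∣m) → mk⊥m (∣m∣n⇒∣m+n i∣m i∣k , i∣m))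
  coprime-+

-- If d ∣ m then d·m and m have the same prime divisors, so φ(d·m) = d·φ(m).
φ-*-divisor : ∀ d m → d ∣ m → φ (d * m) ≡ d * φ m
φ-*-divisor d m d∣m = begin
  φ (d * m)                         ≡⟨ φ≡count (d * m) ⟩
  count (coprimeTo (d * m)) (d * m) ≡⟨ count-cong same-residues (d * m) ⟩
  count (coprimeTo m) (d * m)       ≡⟨ count-periodic (coprimeTo m) m (coprimeTo-periodic m) d ⟩
  d * count (coprimeTo m) m         ≡⟨ cong (d *_) (sym (φ≡count m)) ⟩
  d * φ m                           ∎
  where
  same-residues : ∀ k → coprimeTo (d * m) k ≡ coprimeTo m k
  same-residues k = coprimeTo-⇔ {k = k} {l = k}
    (λ k⊥dm (i∣k , i∣m) → k⊥dm (i∣k , ∣-trans i∣m (divides d refl)))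
    (λ k⊥m → coprime-* (λ (i∣k , i∣d) → k⊥m (i∣k , ∣-trans i∣d d∣m)) k⊥m)

L∞⇒cyclic : ∀ n k → φ (suc n) ∣ n ^ k → Coprime (suc n) (φ (suc n))
L∞⇒cyclic n k φ∣n^k (i∣n+1 , i∣φ) = coprime-^ (coprime-suc n) k (i∣n+1 , ∣-trans i∣φ φ∣n^k)

cyclic⇒squareFree : ∀ n → Coprime n (φ n) → SquareFree n
cyclic⇒squareFree n n⊥φn d (divides q n≡q[dd]) = n⊥φn (d∣n , d∣φn)
  where
  n≡d[qd] : n ≡ d * (q * d)
  n≡d[qd] = trans n≡q[dd] (trans (sym (*-assoc q d d)) (*-comm (q * d) d))
  d∣n : d ∣ n
  d∣n = divides (q * d) (trans n≡q[dd] (sym (*-assoc q d d)))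
  d∣φn : d ∣ φ n
  d∣φn = subst (λ x → d ∣ φ x) (sym n≡d[qd])
    (subst (d ∣_) (sym (φ-*-divisor d (q * d) (divides q refl))) (m∣m*n (φ (q * d))))

mainTheorem4 : (n : ℕ) → n ≥ 1 → (∃[ k ] (k ≥ 1 × InL k n)) → gcd n (φ n) ≡ 1 × SquareFree n
mainTheorem4 (suc n) (s≤s _) (k , _ , φ∣n^k) = coprime⇒gcd≡1 cyclic , cyclic⇒squareFree (suc n) cyclic
  where
  cyclic : Coprime (suc n) (φ (suc n))
  cyclic = L∞⇒cyclic n k φ∣n^k
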